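{- Let $\mathfrak{M}_0=(S,\mathcal{L}_0)$ be a linear space and $\mathfrak{M}=\mathbf{V}_2(\mathfrak{M}_0)$. Let $L_1,K_1,L_2,K_2$ be lines of $\mathfrak{M}$ lying in pairwise distinct leaves. These lines yield a quadrangle without diagonals (i.e. each $L_i$ meets each $K_j$, the points $L_1\cap K_1$ and $L_2\cap K_2$ are not collinear, and the points $L_1\cap K_2$ and $L_2\cap K_1$ are not collinear) if and only if, up to interchanging the pair $(L_1,L_2)$ with the pair $(K_1,K_2)$ and up to interchanging the lines within each of these pairs, one of the following holds: (a) there are lines $m,n$ of $\mathfrak{M}_0$ and points $a_1,b_1\in n$, $a_2,b_2\in m$ such that $L_1=a_1+m$, $L_2=b_1+m$, $K_1=a_2+n$, $K_2=b_2+n$; the vertices of the quadrangle are then $a_1+a_2$, $a_1+b_2$, $a_2+b_1$, $b_1+b_2$; (b) there are three lines $m,n,l$ of $\mathfrak{M}_0$ and points $a,b,c$ with $a,b\in n$, $a,c\in m$, $b,c\in l$ such that $K_1=2n$, $K_2=c+n$, $L_1=a+m$, $L_2=b+l$; the vertices of the quadrangle are then $2a$, $a+c$, $2b$, $b+c$.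
   Context: A partial linear space is a pair $(S,\mathcal{L})$ where $\mathcal{L}$ is a nonempty family of subsets of $S$ (lines), each with at least $3$ points, two distinct points lying on at most one line; it is a linear space if any two distinct points lie on a (unique) line. Two points are collinear if some line contains both. Multisets of size $2$ over $S$ are written $x+y$ ($x,y\in S$), with $2x=x+x$; for $x\in S$ and $B\subseteq S$, $x+B=\{x+y:y\in B\}$ and $2B=\{2y:y\in B\}$. The Veronese space $\mathbf{V}_2(\mathfrak{M}_0)$ has as points all multisets $x+y$ with $x,y\in S$, and as lines all sets $x+L$ ($x\in S$, $L\in\mathcal{L}_0$) and $2L$ ($L\in\mathcal{L}_0$). Its leaves are the sets $x+S$ ($x\in S$) and $2S$; every line lies in exactly one leaf. -}

module Defs where

open import Data.Product using (Σ; ∃; ∃-syntax; _×_; _,_)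
open import Data.Sum using (_⊎_; inj₁; inj₂)
open import Data.Maybe using (Maybe; just; nothing)
open import Relation.Nullary using (¬_)
open import Relation.Binary.PropositionalEquality using (_≡_; _≢_)

record LinearSpace : Set₁ where
  field
    Point : Set
    Line  : Set
    _∈ₗ_  : Point → Line → Set
    someLine : Line
    threePoints : ∀ (ℓ : Line) → ∃[ x ] ∃[ y ] ∃[ z ]
      (x ≢ y × x ≢ z × y ≢ z × x ∈ₗ ℓ × y ∈ₗ ℓ × z ∈ₗ ℓ)
    atMostOne : ∀ {x y : Point} {ℓ ℓ' : Line} → x ≢ y →
      x ∈ₗ ℓ → y ∈ₗ ℓ → x ∈ₗ ℓ' → y ∈ₗ ℓ' → ℓ ≡ ℓ'
    joined : ∀ (x y : Point) → x ≢ y → ∃[ ℓ ] (x ∈ₗ ℓ × y ∈ₗ ℓ)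

module Veronese (M : LinearSpace) where
  open LinearSpace M

  -- a point x + y of V₂ is represented by the pair (x , y);
  -- (x , y) and (y , x) denote the same multiset
  VPoint : Set
  VPoint = Point × Point

  _≈P_ : VPoint → VPoint → Set
  (x , y) ≈P (x' , y') = (x ≡ x' × y ≡ y') ⊎ (x ≡ y' × y ≡ x')

  -- lines of V₂: inj₁ (x , ℓ) is x + ℓ, inj₂ ℓ is 2ℓ
  VLine : Set
  VLine = (Point × Line) ⊎ Line

  _+ℓ_ : Point → Line → VLine
  x +ℓ ℓ = inj₁ (x , ℓ)

  2ℓ : Line → VLine
  2ℓ ℓ = inj₂ ℓ

  _∈V_ : VPoint → VLine → Set
  (u , v) ∈V inj₁ (x , ℓ) = (u ≡ x × v ∈ₗ ℓ) ⊎ (v ≡ x × u ∈ₗ ℓ)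
  (u , v) ∈V inj₂ ℓ       = u ≡ v × u ∈ₗ ℓ

  _≋_ : VLine → VLine → Set
  A ≋ B = ∀ (p : VPoint) → (p ∈V A → p ∈V B) × (p ∈V B → p ∈V A)

  -- the leaf containing a line: just x  for the leaf x + S, nothing for 2S
  leaf : VLine → Maybe Point
  leaf (inj₁ (x , ℓ)) = just x
  leaf (inj₂ ℓ)       = nothing

  Collinear : VPoint → VPoint → Set
  Collinear p q = ∃[ A ] (p ∈V A × q ∈V A)

  Meet : VLine → VLine → Set
  Meet A B = ∃[ p ] (p ∈V A × p ∈V B)

  QuadrangleNoDiag : VLine → VLine → VLine → VLine → Set
  QuadrangleNoDiag L₁ K₁ L₂ K₂ =
    Meet L₁ K₁ × Meet L₁ K₂ × Meet L₂ K₁ × Meet L₂ K₂ ×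
    (∀ p q → p ∈V L₁ → p ∈V K₁ → q ∈V L₂ → q ∈V K₂ → ¬ Collinear p q) ×
    (∀ p q → p ∈V L₁ → p ∈V K₂ → q ∈V L₂ → q ∈V K₁ → ¬ Collinear p q)

  CaseA : VLine → VLine → VLine → VLine → Set
  CaseA L₁ L₂ K₁ K₂ = ∃[ m ] ∃[ n ] ∃[ a₁ ] ∃[ b₁ ] ∃[ a₂ ] ∃[ b₂ ]
    (a₁ ∈ₗ n × b₁ ∈ₗ n × a₂ ∈ₗ m × b₂ ∈ₗ m ×
     L₁ ≋ (a₁ +ℓ m) × L₂ ≋ (b₁ +ℓ m) × K₁ ≋ (a₂ +ℓ n) × K₂ ≋ (b₂ +ℓ n))

  CaseB : VLine → VLine → VLine → VLine → Set
  CaseB L₁ L₂ K₁ K₂ = ∃[ m ] ∃[ n ] ∃[ l ] ∃[ a ] ∃[ b ] ∃[ c ]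
    (a ∈ₗ n × b ∈ₗ n × a ∈ₗ m × c ∈ₗ m × b ∈ₗ l × c ∈ₗ l ×
     K₁ ≋ 2ℓ n × K₂ ≋ (c +ℓ n) × L₁ ≋ (a +ℓ m) × L₂ ≋ (b +ℓ l))

  UpToSym : (VLine → VLine → VLine → VLine → Set) →
            VLine → VLine → VLine → VLine → Set
  UpToSym P L₁ L₂ K₁ K₂ =
    P L₁ L₂ K₁ K₂ ⊎ P L₂ L₁ K₁ K₂ ⊎ P L₁ L₂ K₂ K₁ ⊎ P L₂ L₁ K₂ K₁ ⊎
    P K₁ K₂ L₁ L₂ ⊎ P K₂ K₁ L₁ L₂ ⊎ P K₁ K₂ L₂ L₁ ⊎ P K₂ K₁ L₂ L₁

-- Key facts about V₂: lines x + ℓ and y + k with x ≠ y can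
-- only share x + y (present iff y ∈ ℓ, x ∈ k); x + ℓ meets 2n only in 2x (iff
-- x ∈ ℓ ∩ n); points u + v, u' + v' with disjoint supports, not both of the
-- form 2z, are never collinear, as a line z + ℓ needs the summand z in both.
-- (⇐) The canonical configurations (a), (b) are quadrangles: their vertices
-- are the points above, and opposite vertices have disjoint supports.  Being
-- a quadrangle is invariant under equality of lines as point sets (≋) and under
-- the symmetries of the quadrangle, which also preserve distinctness of leaves;
-- this handles "up to symmetry".
-- (⇒) At most one side is of the form 2n.  If none is, the four meetings and
-- "two points lie on at most one line" give L₁, L₂ a common direction m and
-- K₁, K₂ a common direction n: case (a).  Otherwise the same argument gives
-- case (b) with the diagonal side in the role of K₁.
module Submission where

open import Defs
open import Data.Product using (_×_; _,_; proj₁; proj₂; ∃-syntax)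
open import Data.Sum using (_⊎_; inj₁; inj₂; [_,_]; swap)
open import Data.Maybe using (just)
open import Data.Empty using (⊥-elim)
open import Relation.Nullary using (¬_)
open import Relation.Binary.PropositionalEquality
  using (_≡_; _≢_; refl; sym; trans; cong; ≢-sym)

Distinct : {X : Set} → X → X → X → X → Set
Distinct a b c d = a ≢ b × a ≢ c × a ≢ d × b ≢ c × b ≢ d × c ≢ d

≢-unmap : {X Y : Set} {a b : X} (f : X → Y) → f a ≢ f b → a ≢ b
≢-unmap f fa≢fb a≡b = fa≢fb (cong f a≡b)

Distinct-unmap : {X Y : Set} {a b c d : X} (f : X → Y) →
  Distinct (f a) (f b) (f c) (f d) → Distinct a b c d
Distinct-unmap f (ab , ac , ad , bc , bd , cd) =
  ≢-unmap f ab , ≢-unmap f ac , ≢-unmap f ad , ≢-unmap f bc , ≢-unmap f bd , ≢-unmap f cd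

-- Pairwise distinctness is invariant under the symmetries of a quadrangle
-- a b c d (sides a, c opposite to b, d): swapping a with c, b with d, and
-- swapping the two pairs.
Distinct-swap₁₃ : {X : Set} {a b c d : X} → Distinct a b c d → Distinct c b a d
Distinct-swap₁₃ (ab , ac , ad , bc , bd , cd) =
  ≢-sym bc , ≢-sym ac , cd , ≢-sym ab , bd , ad

Distinct-swap₂₄ : {X : Set} {a b c d : X} → Distinct a b c d → Distinct a d c b
Distinct-swap₂₄ (ab , ac , ad , bc , bd , cd) =
  ad , ac , ab , ≢-sym cd , ≢-sym bd , ≢-sym bc

Distinct-swapPairs : {X : Set} {a b c d : X} → Distinct a b c d → Distinct b a d c
Distinct-swapPairs (ab , ac , ad , bc , bd , cd) =
  ≢-sym ab , bd , bc , ad , ac , ≢-sym cd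

module Quadrangles (M : LinearSpace) where
  open LinearSpace M
  open Veronese M

  DistinctLeaves : VLine → VLine → VLine → VLine → Set
  DistinctLeaves L₁ K₁ L₂ K₂ = Distinct (leaf L₁) (leaf K₁) (leaf L₂) (leaf K₂)

  IsSum : VPoint → Point → Point → Set
  IsSum p x y = p ≡ (x , y) ⊎ p ≡ (y , x)

  ≋-refl : {A : VLine} → A ≋ A
  ≋-refl p = (λ h → h) , (λ h → h)

  ≡⇒≋ : {A B : VLine} → A ≡ B → A ≋ B
  ≡⇒≋ refl = ≋-refl

  twoPoints : (ℓ : Line) → ∃[ y ] ∃[ y' ] (y ≢ y' × y ∈ₗ ℓ × y' ∈ₗ ℓ)
  twoPoints ℓ with threePoints ℓ
  ... | y , y' , _ , yy' , _ , _ , yℓ , y'ℓ , _ = y , y' , yy' , yℓ , y'ℓ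

  ∈V-swap : {u v : Point} {A : VLine} → (u , v) ∈V A → (v , u) ∈V A
  ∈V-swap {A = inj₁ _} h = swap h
  ∈V-swap {A = inj₂ _} (refl , uℓ) = refl , uℓ

  ∈V-sum : {p : VPoint} {x y : Point} {A : VLine} → IsSum p x y → p ∈V A → (x , y) ∈V A
  ∈V-sum (inj₁ refl) h = h
  ∈V-sum (inj₂ refl) h = ∈V-swap h

  -- A line equal (as a point set) to x + ℓ lies in the leaf x + S: it contains
  -- x + y and x + y' for distinct y, y' ∈ ℓ, and x is their only common summand.
  leaf-≋-sum : {L : VLine} {x : Point} {ℓ : Line} → L ≋ (x +ℓ ℓ) → leaf L ≡ just x
  leaf-≋-sum {L} {x} {ℓ} L≋xℓ with twoPoints ℓ
  ... | y , y' , yy' , yℓ , y'ℓ =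
    onLine L (proj₂ (L≋xℓ (x , y)) (inj₁ (refl , yℓ))) (proj₂ (L≋xℓ (x , y')) (inj₁ (refl , y'ℓ)))
    where
    onLine : (L : VLine) → (x , y) ∈V L → (x , y') ∈V L → leaf L ≡ just x
    onLine (inj₁ _) (inj₁ (x≡z , _)) _ = cong just (sym x≡z)
    onLine (inj₁ _) _ (inj₁ (x≡z , _)) = cong just (sym x≡z)
    onLine (inj₁ _) (inj₂ (y≡z , _)) (inj₂ (y'≡z , _)) = ⊥-elim (yy' (trans y≡z (sym y'≡z)))
    onLine (inj₂ _) (x≡y , _) (x≡y' , _) = ⊥-elim (yy' (trans (sym x≡y) x≡y'))

  distinct-bases : {A B : VLine} {x y : Point} →
    leaf A ≡ just x → leaf B ≡ just y → leaf A ≢ leaf B → x ≢ y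
  distinct-bases A∈x B∈y d x≡y = d (trans A∈x (trans (cong just x≡y) (sym B∈y)))

  sums-meet : {x y : Point} {ℓ k : Line} → x ≢ y → Meet (x +ℓ ℓ) (y +ℓ k) → y ∈ₗ ℓ × x ∈ₗ k
  sums-meet xy (_ , inj₁ (refl , _) , inj₁ (x≡y , _)) = ⊥-elim (xy x≡y)
  sums-meet xy (_ , inj₁ (refl , yℓ) , inj₂ (refl , xk)) = yℓ , xk
  sums-meet xy (_ , inj₂ (refl , yℓ) , inj₁ (refl , xk)) = yℓ , xk
  sums-meet xy (_ , inj₂ (refl , _) , inj₂ (x≡y , _)) = ⊥-elim (xy x≡y)

  sums-common-point : {x y : Point} {ℓ k : Line} {p : VPoint} → x ≢ y →
    p ∈V (x +ℓ ℓ) → p ∈V (y +ℓ k) → IsSum p x y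
  sums-common-point xy (inj₁ (refl , _)) (inj₁ (x≡y , _)) = ⊥-elim (xy x≡y)
  sums-common-point xy (inj₁ (refl , _)) (inj₂ (refl , _)) = inj₁ refl
  sums-common-point xy (inj₂ (refl , _)) (inj₁ (refl , _)) = inj₂ refl
  sums-common-point xy (inj₂ (refl , _)) (inj₂ (x≡y , _)) = ⊥-elim (xy x≡y)

  sum-meets-diagonal : {x : Point} {ℓ n : Line} → Meet (x +ℓ ℓ) (2ℓ n) → x ∈ₗ ℓ × x ∈ₗ n
  sum-meets-diagonal (_ , inj₁ (refl , xℓ) , (refl , xn)) = xℓ , xn
  sum-meets-diagonal (_ , inj₂ (refl , xℓ) , (refl , xn)) = xℓ , xn

  sum-diagonal-common-point : {x : Point} {ℓ n : Line} {p : VPoint} →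
    p ∈V (x +ℓ ℓ) → p ∈V (2ℓ n) → IsSum p x x
  sum-diagonal-common-point (inj₁ (refl , _)) (refl , _) = inj₁ refl
  sum-diagonal-common-point (inj₂ (refl , _)) (refl , _) = inj₁ refl

  -- Points u + v and u' + v' with disjoint supports, not both of the form 2z,
  -- are not collinear: a line z + ℓ needs the summand z in both, a line 2ℓ
  -- contains only points 2z.
  disjoint-noncollinear : {u v u' v' : Point} → (u ≢ v ⊎ u' ≢ v') →
    u ≢ u' → u ≢ v' → v ≢ u' → v ≢ v' → ¬ Collinear (u , v) (u' , v')
  disjoint-noncollinear _ uu' _ _ _ (inj₁ _ , inj₁ (u≡z , _) , inj₁ (u'≡z , _)) = uu' (trans u≡z (sym u'≡z))
  disjoint-noncollinear _ _ uv' _ _ (inj₁ _ , inj₁ (u≡z , _) , inj₂ (v'≡z , _)) = uv' (trans u≡z (sym v'≡z))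
  disjoint-noncollinear _ _ _ vu' _ (inj₁ _ , inj₂ (v≡z , _) , inj₁ (u'≡z , _)) = vu' (trans v≡z (sym u'≡z))
  disjoint-noncollinear _ _ _ _ vv' (inj₁ _ , inj₂ (v≡z , _) , inj₂ (v'≡z , _)) = vv' (trans v≡z (sym v'≡z))
  disjoint-noncollinear nondiag _ _ _ _ (inj₂ _ , (u≡v , _) , (u'≡v' , _)) =
    [ (λ uv → uv u≡v) , (λ u'v' → u'v' u'≡v') ] nondiag

  sums-noncollinear : {p q : VPoint} {x y z w : Point} → IsSum p x y → IsSum q z w →
    (x ≢ y ⊎ z ≢ w) → x ≢ z → x ≢ w → y ≢ z → y ≢ w → ¬ Collinear p q
  sums-noncollinear p≐xy q≐zw nondiag xz xw yz yw (A , pA , qA) =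
    disjoint-noncollinear nondiag xz xw yz yw (A , ∈V-sum p≐xy pA , ∈V-sum q≐zw qA)

  meet-sym : {A B : VLine} → Meet A B → Meet B A
  meet-sym (p , pA , pB) = p , pB , pA

  quadrangle-≋ : {L₁ K₁ L₂ K₂ L₁' K₁' L₂' K₂' : VLine} →
    L₁ ≋ L₁' → K₁ ≋ K₁' → L₂ ≋ L₂' → K₂ ≋ K₂' →
    QuadrangleNoDiag L₁' K₁' L₂' K₂' → QuadrangleNoDiag L₁ K₁ L₂ K₂
  quadrangle-≋ eL₁ eK₁ eL₂ eK₂ (m₁₁ , m₁₂ , m₂₁ , m₂₂ , diag₁ , diag₂) =
    meet eL₁ eK₁ m₁₁ , meet eL₁ eK₂ m₁₂ , meet eL₂ eK₁ m₂₁ , meet eL₂ eK₂ m₂₂ ,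
    (λ p q pL pK qL qK → diag₁ p q (to eL₁ pL) (to eK₁ pK) (to eL₂ qL) (to eK₂ qK)) ,
    (λ p q pL pK qL qK → diag₂ p q (to eL₁ pL) (to eK₂ pK) (to eL₂ qL) (to eK₁ qK))
    where
    to : {A A' : VLine} {p : VPoint} → A ≋ A' → p ∈V A → p ∈V A'
    to {p = p} e = proj₁ (e p)
    meet : {A A' B B' : VLine} → A ≋ A' → B ≋ B' → Meet A' B' → Meet A B
    meet eA eB (p , pA , pB) = p , proj₂ (eA p) pA , proj₂ (eB p) pB

  quadrangle-swap₁₃ : {A B C D : VLine} → QuadrangleNoDiag A B C D → QuadrangleNoDiag C B A D
  quadrangle-swap₁₃ (mAB , mAD , mCB , mCD , diag₁ , diag₂) =
    mCB , mCD , mAB , mAD ,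
    (λ p q pC pB qA qD (E , pE , qE) → diag₂ q p qA qD pC pB (E , qE , pE)) ,
    (λ p q pC pD qA qB (E , pE , qE) → diag₁ q p qA qB pC pD (E , qE , pE))

  quadrangle-swap₂₄ : {A B C D : VLine} → QuadrangleNoDiag A B C D → QuadrangleNoDiag A D C B
  quadrangle-swap₂₄ (mAB , mAD , mCB , mCD , diag₁ , diag₂) = mAD , mAB , mCD , mCB , diag₂ , diag₁

  quadrangle-swapPairs : {A B C D : VLine} → QuadrangleNoDiag A B C D → QuadrangleNoDiag B A D C
  quadrangle-swapPairs (mAB , mAD , mCB , mCD , diag₁ , diag₂) =
    meet-sym mAB , meet-sym mCB , meet-sym mAD , meet-sym mCD ,
    (λ p q pB pA qD qC → diag₁ p q pA pB qC qD) ,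
    (λ p q pB pC qD qA (E , pE , qE) → diag₂ q p qA qD pC pB (E , qE , pE))

  caseA-quadrangle : {m n : Line} {a₁ b₁ a₂ b₂ : Point} → Distinct a₁ a₂ b₁ b₂ →
    a₁ ∈ₗ n → b₁ ∈ₗ n → a₂ ∈ₗ m → b₂ ∈ₗ m →
    QuadrangleNoDiag (a₁ +ℓ m) (a₂ +ℓ n) (b₁ +ℓ m) (b₂ +ℓ n)
  caseA-quadrangle (a₁a₂ , a₁b₁ , a₁b₂ , a₂b₁ , a₂b₂ , b₁b₂) a₁n b₁n a₂m b₂m =
    (_ , inj₁ (refl , a₂m) , inj₂ (refl , a₁n)) ,
    (_ , inj₁ (refl , b₂m) , inj₂ (refl , a₁n)) ,
    (_ , inj₁ (refl , a₂m) , inj₂ (refl , b₁n)) ,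
    (_ , inj₁ (refl , b₂m) , inj₂ (refl , b₁n)) ,
    (λ p q pL pK qL qK →
      sums-noncollinear (sums-common-point a₁a₂ pL pK) (sums-common-point b₁b₂ qL qK)
        (inj₁ a₁a₂) a₁b₁ a₁b₂ a₂b₁ a₂b₂) ,
    (λ p q pL pK qL qK →
      sums-noncollinear (sums-common-point a₁b₂ pL pK) (sums-common-point (≢-sym a₂b₁) qL qK)
        (inj₁ a₁b₂) a₁b₁ a₁a₂ (≢-sym b₁b₂) (≢-sym a₂b₂))

  caseB-quadrangle : {m n l : Line} {a b c : Point} → a ≢ b → a ≢ c → b ≢ c →
    a ∈ₗ n → b ∈ₗ n → a ∈ₗ m → c ∈ₗ m → b ∈ₗ l → c ∈ₗ l →
    QuadrangleNoDiag (a +ℓ m) (2ℓ n) (b +ℓ l) (c +ℓ n)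
  caseB-quadrangle ab ac bc an bn am cm bl cl =
    (_ , inj₁ (refl , am) , (refl , an)) ,
    (_ , inj₁ (refl , cm) , inj₂ (refl , an)) ,
    (_ , inj₁ (refl , bl) , (refl , bn)) ,
    (_ , inj₁ (refl , cl) , inj₂ (refl , bn)) ,
    (λ p q pL pK qL qK →
      sums-noncollinear (sum-diagonal-common-point pL pK) (sums-common-point bc qL qK)
        (inj₂ bc) ab ac ab ac) ,
    (λ p q pL pK qL qK →
      sums-noncollinear (sums-common-point ac pL pK) (sum-diagonal-common-point qL qK)
        (inj₁ ac) ab ab (≢-sym bc) (≢-sym bc))

  Yields : (VLine → VLine → VLine → VLine → Set) → Set
  Yields P = (L₁ K₁ L₂ K₂ : VLine) → DistinctLeaves L₁ K₁ L₂ K₂ →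
    P L₁ L₂ K₁ K₂ → QuadrangleNoDiag L₁ K₁ L₂ K₂

  -- Configuration (a), given up to ≋: distinct leaves make the bases distinct.
  caseA-yields : Yields CaseA
  caseA-yields L₁ K₁ L₂ K₂ (d₁ , d₂ , d₃ , d₄ , d₅ , d₆)
    (_ , _ , a₁ , b₁ , a₂ , b₂ , a₁n , b₁n , a₂m , b₂m , eL₁ , eL₂ , eK₁ , eK₂) =
    quadrangle-≋ eL₁ eK₁ eL₂ eK₂ (caseA-quadrangle distinct a₁n b₁n a₂m b₂m)
    where
    distinct : Distinct a₁ a₂ b₁ b₂
    distinct = distinct-bases (leaf-≋-sum eL₁) (leaf-≋-sum eK₁) d₁ ,
               distinct-bases (leaf-≋-sum eL₁) (leaf-≋-sum eL₂) d₂ ,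
               distinct-bases (leaf-≋-sum eL₁) (leaf-≋-sum eK₂) d₃ ,
               distinct-bases (leaf-≋-sum eK₁) (leaf-≋-sum eL₂) d₄ ,
               distinct-bases (leaf-≋-sum eK₁) (leaf-≋-sum eK₂) d₅ ,
               distinct-bases (leaf-≋-sum eL₂) (leaf-≋-sum eK₂) d₆

  -- Configuration (b), given up to ≋; only the bases of L₁, L₂, K₂ matter.
  caseB-yields : Yields CaseB
  caseB-yields L₁ K₁ L₂ K₂ (_ , d₂ , d₃ , _ , _ , d₆)
    (_ , _ , _ , _ , _ , _ , an , bn , am , cm , bl , cl , eK₁ , eK₂ , eL₁ , eL₂) =
    quadrangle-≋ eL₁ eK₁ eL₂ eK₂
      (caseB-quadrangle (distinct-bases (leaf-≋-sum eL₁) (leaf-≋-sum eL₂) d₂)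
        (distinct-bases (leaf-≋-sum eL₁) (leaf-≋-sum eK₂) d₃)
        (distinct-bases (leaf-≋-sum eL₂) (leaf-≋-sum eK₂) d₆) an bn am cm bl cl)

  -- Since both hypothesis and conclusion are symmetric, a configuration
  -- yields a quadrangle also up to symmetry.
  upToSym-yields : {P : VLine → VLine → VLine → VLine → Set} → Yields P → Yields (UpToSym P)
  upToSym-yields yields L₁ K₁ L₂ K₂ d (inj₁ h) = yields L₁ K₁ L₂ K₂ d h
  upToSym-yields yields L₁ K₁ L₂ K₂ d (inj₂ (inj₁ h)) =
    quadrangle-swap₁₃ (yields L₂ K₁ L₁ K₂ (Distinct-swap₁₃ d) h)
  upToSym-yields yields L₁ K₁ L₂ K₂ d (inj₂ (inj₂ (inj₁ h))) =
    quadrangle-swap₂₄ (yields L₁ K₂ L₂ K₁ (Distinct-swap₂₄ d) h)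
  upToSym-yields yields L₁ K₁ L₂ K₂ d (inj₂ (inj₂ (inj₂ (inj₁ h)))) =
    quadrangle-swap₂₄ (quadrangle-swap₁₃
      (yields L₂ K₂ L₁ K₁ (Distinct-swap₁₃ (Distinct-swap₂₄ d)) h))
  upToSym-yields yields L₁ K₁ L₂ K₂ d (inj₂ (inj₂ (inj₂ (inj₂ (inj₁ h))))) =
    quadrangle-swapPairs (yields K₁ L₁ K₂ L₂ (Distinct-swapPairs d) h)
  upToSym-yields yields L₁ K₁ L₂ K₂ d (inj₂ (inj₂ (inj₂ (inj₂ (inj₂ (inj₁ h)))))) =
    quadrangle-swapPairs (quadrangle-swap₁₃
      (yields K₂ L₁ K₁ L₂ (Distinct-swap₁₃ (Distinct-swapPairs d)) h))
  upToSym-yields yields L₁ K₁ L₂ K₂ d (inj₂ (inj₂ (inj₂ (inj₂ (inj₂ (inj₂ (inj₁ h))))))) =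
    quadrangle-swapPairs (quadrangle-swap₂₄
      (yields K₁ L₂ K₂ L₁ (Distinct-swap₂₄ (Distinct-swapPairs d)) h))
  upToSym-yields yields L₁ K₁ L₂ K₂ d (inj₂ (inj₂ (inj₂ (inj₂ (inj₂ (inj₂ (inj₂ h))))))) =
    quadrangle-swapPairs (quadrangle-swap₁₃ (quadrangle-swap₂₄
      (yields K₂ L₂ K₁ L₁ (Distinct-swap₂₄ (Distinct-swap₁₃ (Distinct-swapPairs d))) h)))

  -- (⇒) without diagonal sides: the four meetings put y₁, y₂ on both l₁ and l₂
  -- and x₁, x₂ on both k₁ and k₂, so l₁ = l₂ and k₁ = k₂.
  meets-caseA : {x₁ x₂ y₁ y₂ : Point} {l₁ l₂ k₁ k₂ : Line} → Distinct x₁ y₁ x₂ y₂ →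
    Meet (x₁ +ℓ l₁) (y₁ +ℓ k₁) → Meet (x₁ +ℓ l₁) (y₂ +ℓ k₂) →
    Meet (x₂ +ℓ l₂) (y₁ +ℓ k₁) → Meet (x₂ +ℓ l₂) (y₂ +ℓ k₂) →
    CaseA (x₁ +ℓ l₁) (x₂ +ℓ l₂) (y₁ +ℓ k₁) (y₂ +ℓ k₂)
  meets-caseA {x₁} {x₂} {y₁} {y₂} {l₁} {l₂} {k₁} {k₂}
    (x₁y₁ , x₁x₂ , x₁y₂ , y₁x₂ , y₁y₂ , x₂y₂) m₁₁ m₁₂ m₂₁ m₂₂
    with sums-meet x₁y₁ m₁₁ | sums-meet x₁y₂ m₁₂
       | sums-meet (≢-sym y₁x₂) m₂₁ | sums-meet x₂y₂ m₂₂
  ... | y₁l₁ , x₁k₁ | y₂l₁ , x₁k₂ | y₁l₂ , x₂k₁ | y₂l₂ , x₂k₂ =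
    l₁ , k₁ , x₁ , x₂ , y₁ , y₂ , x₁k₁ , x₂k₁ , y₁l₁ , y₂l₁ ,
    ≋-refl , ≡⇒≋ (cong (x₂ +ℓ_) (sym l₁≡l₂)) , ≋-refl , ≡⇒≋ (cong (y₂ +ℓ_) (sym k₁≡k₂))
    where
    l₁≡l₂ : l₁ ≡ l₂
    l₁≡l₂ = atMostOne y₁y₂ y₁l₁ y₂l₁ y₁l₂ y₂l₂
    k₁≡k₂ : k₁ ≡ k₂
    k₁≡k₂ = atMostOne x₁x₂ x₁k₁ x₂k₁ x₁k₂ x₂k₂

  -- (⇒) with a diagonal side 2n opposite to y + k: the meetings put x₁, x₂ on
  -- both k and n, so k = n.
  meets-caseB : {x₁ x₂ y : Point} {l₁ l₂ k n : Line} → x₁ ≢ x₂ → x₁ ≢ y → x₂ ≢ y →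
    Meet (x₁ +ℓ l₁) (2ℓ n) → Meet (x₂ +ℓ l₂) (2ℓ n) →
    Meet (x₁ +ℓ l₁) (y +ℓ k) → Meet (x₂ +ℓ l₂) (y +ℓ k) →
    CaseB (x₁ +ℓ l₁) (x₂ +ℓ l₂) (2ℓ n) (y +ℓ k)
  meets-caseB {x₁} {x₂} {y} {l₁} {l₂} {k} {n} x₁x₂ x₁y x₂y m₁n m₂n m₁k m₂k
    with sum-meets-diagonal m₁n | sum-meets-diagonal m₂n | sums-meet x₁y m₁k | sums-meet x₂y m₂k
  ... | x₁l₁ , x₁n | x₂l₂ , x₂n | yl₁ , x₁k | yl₂ , x₂k =
    l₁ , n , l₂ , x₁ , x₂ , y , x₁n , x₂n , x₁l₁ , yl₁ , x₂l₂ , yl₂ ,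
    ≋-refl , ≡⇒≋ (cong (y +ℓ_) k≡n) , ≋-refl , ≋-refl
    where
    k≡n : k ≡ n
    k≡n = atMostOne x₁x₂ x₁k x₂k x₁n x₂n

  -- (⇒) in general: at most one side is diagonal; the cases where it is L₁, L₂
  -- or K₂ are the symmetric images (positions 5, 7 and 3 of UpToSym) of the
  -- case where it is K₁.
  quadrangle-cases : (L₁ K₁ L₂ K₂ : VLine) → DistinctLeaves L₁ K₁ L₂ K₂ →
    QuadrangleNoDiag L₁ K₁ L₂ K₂ → UpToSym CaseA L₁ L₂ K₁ K₂ ⊎ UpToSym CaseB L₁ L₂ K₁ K₂
  quadrangle-cases (inj₁ _) (inj₁ _) (inj₁ _) (inj₁ _) d (m₁₁ , m₁₂ , m₂₁ , m₂₂ , _) =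
    inj₁ (inj₁ (meets-caseA (Distinct-unmap just d) m₁₁ m₁₂ m₂₁ m₂₂))
  quadrangle-cases (inj₁ _) (inj₂ _) (inj₁ _) (inj₁ _) (_ , d₂ , d₃ , _ , _ , d₆) (m₁₁ , m₁₂ , m₂₁ , m₂₂ , _) =
    inj₂ (inj₁ (meets-caseB (≢-unmap just d₂) (≢-unmap just d₃) (≢-unmap just d₆) m₁₁ m₂₁ m₁₂ m₂₂))
  quadrangle-cases (inj₁ _) (inj₁ _) (inj₁ _) (inj₂ _) (d₁ , d₂ , _ , d₄ , _ , _) (m₁₁ , m₁₂ , m₂₁ , m₂₂ , _) =
    inj₂ (inj₂ (inj₂ (inj₁
      (meets-caseB (≢-unmap just d₂) (≢-unmap just d₁) (≢-unmap just (≢-sym d₄)) m₁₂ m₂₂ m₁₁ m₂₁))))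
  quadrangle-cases (inj₂ _) (inj₁ _) (inj₁ _) (inj₁ _) (_ , _ , _ , d₄ , d₅ , d₆) (m₁₁ , m₁₂ , m₂₁ , m₂₂ , _) =
    inj₂ (inj₂ (inj₂ (inj₂ (inj₂ (inj₁
      (meets-caseB (≢-unmap just d₅) (≢-unmap just d₄) (≢-unmap just (≢-sym d₆))
        (meet-sym m₁₁) (meet-sym m₁₂) (meet-sym m₂₁) (meet-sym m₂₂)))))))
  quadrangle-cases (inj₁ _) (inj₁ _) (inj₂ _) (inj₁ _) (d₁ , _ , d₃ , _ , d₅ , _) (m₁₁ , m₁₂ , m₂₁ , m₂₂ , _) =
    inj₂ (inj₂ (inj₂ (inj₂ (inj₂ (inj₂ (inj₂ (inj₁
      (meets-caseB (≢-unmap just d₅) (≢-unmap just (≢-sym d₁)) (≢-unmap just (≢-sym d₃))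
        (meet-sym m₂₁) (meet-sym m₂₂) (meet-sym m₁₁) (meet-sym m₁₂)))))))))
  quadrangle-cases (inj₂ _) (inj₂ _) _ _ (d₁ , _) _ = ⊥-elim (d₁ refl)
  quadrangle-cases (inj₂ _) _ (inj₂ _) _ (_ , d₂ , _) _ = ⊥-elim (d₂ refl)
  quadrangle-cases (inj₂ _) _ _ (inj₂ _) (_ , _ , d₃ , _) _ = ⊥-elim (d₃ refl)
  quadrangle-cases _ (inj₂ _) (inj₂ _) _ (_ , _ , _ , d₄ , _) _ = ⊥-elim (d₄ refl)
  quadrangle-cases _ (inj₂ _) _ (inj₂ _) (_ , _ , _ , _ , d₅ , _) _ = ⊥-elim (d₅ refl)
  quadrangle-cases _ _ (inj₂ _) (inj₂ _) (_ , _ , _ , _ , _ , d₆) _ = ⊥-elim (d₆ refl)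

lemma1p8 : (M : LinearSpace) → let open Veronese M in
    (L₁ K₁ L₂ K₂ : VLine) →
    leaf L₁ ≢ leaf K₁ → leaf L₁ ≢ leaf L₂ → leaf L₁ ≢ leaf K₂ →
    leaf K₁ ≢ leaf L₂ → leaf K₁ ≢ leaf K₂ → leaf L₂ ≢ leaf K₂ →
    (QuadrangleNoDiag L₁ K₁ L₂ K₂ →
      UpToSym CaseA L₁ L₂ K₁ K₂ ⊎ UpToSym CaseB L₁ L₂ K₁ K₂) ×
    (UpToSym CaseA L₁ L₂ K₁ K₂ ⊎ UpToSym CaseB L₁ L₂ K₁ K₂ →
      QuadrangleNoDiag L₁ K₁ L₂ K₂)
lemma1p8 M L₁ K₁ L₂ K₂ d₁ d₂ d₃ d₄ d₅ d₆ =
  quadrangle-cases L₁ K₁ L₂ K₂ distinct ,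
  [ upToSym-yields caseA-yields L₁ K₁ L₂ K₂ distinct
  , upToSym-yields caseB-yields L₁ K₁ L₂ K₂ distinct ]
  where
  open Quadrangles M
  distinct : DistinctLeaves L₁ K₁ L₂ K₂
  distinct = d₁ , d₂ , d₃ , d₄ , d₅ , d₆
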